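{- There exists a subset of $\mathbb{N}$ which is an $IP^{\star}$-set in $(\mathbb{N},+)$ but not an $IP^{2\star}$-set.
   Context: A set $A\subseteq\mathbb{N}$ is an $IP$-set if there is a sequence $\langle x_n\rangle_{n=1}^{\infty}$ in $\mathbb{N}$ with $FS(\langle x_n\rangle_{n=1}^\infty)=\{\sum_{t\in H}x_t:H \text{ a nonempty finite subset of }\mathbb{N}\}\subseteq A$; an $IP^{\star}$-set is a set meeting every $IP$-set. For finite nonempty $H,K\subseteq\mathbb{N}$, $H<K$ means $\max H<\min K$. For $n\in\mathbb{N}$, $A$ is an $IP^{n}$-set if there exist sequences $\langle x_{i,t}\rangle_{t=1}^{\infty}$, $i=1,\dots,n$, in $\mathbb{N}$ such that $\{\sum_{i=1}^{n}\sum_{t\in H_i}x_{i,t}:H_1<H_2<\cdots<H_n \text{ nonempty finite subsets of }\mathbb{N}\}\subseteq A$; $A$ is an $IP^{n\star}$-set if it meets every $IP^{n}$-set. -}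

module Defs where

open import Data.Nat using (ℕ; zero; suc; _+_; _<_)
open import Data.Fin using (Fin; toℕ)
open import Data.List using (List; []; _∷_; map; tabulate)
open import Data.Nat.ListAction using (sum)
open import Data.Empty using (⊥)
open import Data.Unit using (⊤)
open import Data.List.Relation.Unary.All using (All)
open import Data.List.Relation.Unary.Unique.Propositional using (Unique)
open import Data.Product using (Σ; ∃; _×_)
open import Relation.Binary.PropositionalEquality using (_≡_)
open import Relation.Nullary using (¬_)

-- Subsets of ℕ are predicates.  The paper's ℕ = {1,2,...}; the terms of
-- all sequences are required to be positive.
Subset : Set₁
Subset = ℕ → Set

-- A nonempty finite subset of ℕ, represented by a nonempty list of
-- distinct elements.
NonEmpty : List ℕ → Set
NonEmpty [] = ⊥
NonEmpty (_ ∷ _) = ⊤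

IsFinSet : List ℕ → Set
IsFinSet H = NonEmpty H × Unique H

_≺_ : List ℕ → List ℕ → Set
H ≺ K = All (λ a → All (λ b → a < b) K) H

ΣH : (ℕ → ℕ) → List ℕ → ℕ
ΣH x H = sum (map x H)

Positive : (ℕ → ℕ) → Set
Positive x = ∀ t → 0 < x t

IPSet : Subset → Set
IPSet A = Σ (ℕ → ℕ) λ x → Positive x ×
  (∀ (H : List ℕ) → IsFinSet H → A (ΣH x H))

Meets : Subset → Subset → Set
Meets A B = ∃ λ m → A m × B m

IPStar : Subset → Set₁
IPStar A = ∀ (B : Subset) → IPSet B → Meets A B

IPnSet : ℕ → Subset → Set
IPnSet n A = Σ (Fin n → ℕ → ℕ) λ x → (∀ i → Positive (x i)) ×
  (∀ (H : Fin n → List ℕ) →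
     (∀ i → IsFinSet (H i)) →
     (∀ (i j : Fin n) → suc (toℕ i) ≡ toℕ j → H i ≺ H j) →
     A (sum (tabulate (λ i → ΣH (x i) (H i)))))

IPnStar : ℕ → Subset → Set₁
IPnStar n A = ∀ (B : Subset) → IPnSet n B → Meets A B

-- Let B be the set of n whose base-3 digits, read from the least significant one, form a word
-- of 0*1{0,1}*2{0,2}*.  The sequences 3ᵗ and 2·3ᵗ exhibit B as an IP²-set: for H₁ < H₂ the sum
-- Σ_{t ∈ H₁} 3ᵗ + Σ_{t ∈ H₂} 2·3ᵗ has digit 1 on H₁, 2 on H₂ and 0 elsewhere; so ∁B is not IP²*.
-- Every IP-set FS(x) meets ∁B: with a = x₀, pigeonhole gives a block sum s of x₁, x₂, … divisible
-- by 3ᵃ, and a, s, a + s ∈ FS(x).  As a < 3ᵃ, the word of a + s is that of a followed by that of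
-- s / 3ᵃ; if a, s ∈ B, it has a 2 before a 1, so a + s ∉ B.
module Submission where

open import Defs
open import Data.Nat.Base
open import Data.Nat.Properties
open import Data.Nat.DivMod
open import Data.Nat.Divisibility using (_∣_; divides; divides-refl; ∣m+n∣m⇒∣n; n∣m*n)
open import Data.Fin.Base using (Fin; toℕ; zero; suc)
open import Data.Fin.Properties using (pigeonhole; fromℕ<-injective)
open import Data.List.Base using ([]; _∷_; iterate)
open import Data.List.Extrema.Nat using (min; argmin-sel; min≤⊤; min≤xs)
open import Data.List.Membership.Propositional using (_∈_; _∉_)
open import Data.List.Membership.DecPropositional _≟_ using (_∈?_)
open import Data.List.Relation.Unary.All as All using (All; []; _∷_; lookup)
open import Data.List.Relation.Unary.All.Properties using (All¬⇒¬Any)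
open import Data.List.Relation.Unary.Any using (here; there)
open import Data.List.Relation.Unary.AllPairs using ([]; _∷_)
open import Data.List.Relation.Unary.Unique.Propositional using (Unique)
open import Data.Product using (Σ; _×_; _,_; proj₁; proj₂; ∃₂)
open import Data.Sum using (_⊎_; inj₁; inj₂; [_,_]′)
open import Data.Empty using (⊥-elim)
open import Data.Unit using (tt)
open import Function using (id)
open import Relation.Nullary using (¬_; Dec; yes; no)
open import Relation.Unary using (∁; Decidable)
open import Relation.Binary.PropositionalEquality
  using (_≡_; _≢_; refl; sym; trans; cong; cong₂; subst; module ≡-Reasoning)

n<m^n : ∀ m → 1 < m → ∀ n → n < m ^ n
n<m^n m@(suc _) 1<m zero    = z<s
n<m^n m@(suc _) 1<m (suc n) = begin-strict
  suc n               ≡⟨ +-identityʳ (suc n) ⟨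
  suc n + 0           <⟨ +-mono-≤-< (n<m^n m 1<m n) (m^n>0 m n) ⟩
  m ^ n + m ^ n       ≡⟨ cong (m ^ n +_) (+-identityʳ (m ^ n)) ⟨
  2 * m ^ n           ≤⟨ *-monoˡ-≤ (m ^ n) 1<m ⟩
  m * m ^ n           ∎
  where open ≤-Reasoning

restrict-< : ∀ {P : ℕ → Set} {j} → (∀ {i} → i < suc j → P i) → ∀ {i} → i < j → P i
restrict-< P i<j = P (m<n⇒m<1+n i<j)

module Digits (b : ℕ) .{{_ : NonZero b}} where

  digit : ℕ → ℕ → ℕ
  digit n zero    = n % b
  digit n (suc j) = digit (n / b) j

  place : ℕ → ℕ → ℕ
  place c t = c * b ^ t

  place-suc : ∀ c t → place c (suc t) ≡ place c t * b
  place-suc c t = trans (cong (c *_) (*-comm b (b ^ t))) (sym (*-assoc c (b ^ t) b))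

  [m+kb]/b≡m/b+k : ∀ m k → (m + k * b) / b ≡ m / b + k
  [m+kb]/b≡m/b+k m k = trans (+-distrib-/-∣ʳ m (divides-refl k)) (cong (m / b +_) (m*n/n≡m k b))

  [m+place]/b : ∀ m s L → (m + place s (suc L)) / b ≡ m / b + place s L
  [m+place]/b m s L =
    trans (cong (λ z → (m + z) / b) (place-suc s L)) ([m+kb]/b≡m/b+k m (place s L))

  [m+place]%b : ∀ m s L → (m + place s (suc L)) % b ≡ m % b
  [m+place]%b m s L =
    trans (cong (λ z → (m + z) % b) (place-suc s L)) ([m+kn]%n≡m%n m (place s L) b)

  /b-<-^ : ∀ {m} L → m < b ^ suc L → m / b < b ^ L
  /b-<-^ {m} L m<b^[1+L] = m<n*o⇒m/o<n (subst (m <_) (*-comm b (b ^ L)) m<b^[1+L])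

  digit-small : ∀ {n} j → n < b ^ j → digit n j ≡ 0
  digit-small zero    (s≤s z≤n) = m<n⇒m%n≡m (>-nonZero⁻¹ b)
  digit-small (suc j) n<b^[1+j] = digit-small j (/b-<-^ j n<b^[1+j])

  digit-zero : ∀ j → digit 0 j ≡ 0
  digit-zero j = digit-small j (m^n>0 b j)

  digit-vanishes : ∀ {n N j} → n < b ^ N → N ≤ j → digit n j ≡ 0
  digit-vanishes {j = j} n<b^N N≤j = digit-small j (<-≤-trans n<b^N (^-monoʳ-≤ b N≤j))

  digit-low : ∀ {a} L s → a < b ^ L → ∀ {j} → j < L → digit (a + place s L) j ≡ digit a j
  digit-low {a} (suc L) s _ {zero} _ = [m+place]%b a s L
  digit-low {a} (suc L) s a<b^[1+L] {suc j} (s≤s j<L) =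
    trans (cong (λ z → digit z j) ([m+place]/b a s L))
      (digit-low L s (/b-<-^ L a<b^[1+L]) j<L)

  digit-high : ∀ {a} L s → a < b ^ L → ∀ j → digit (a + place s L) (L + j) ≡ digit s j
  digit-high zero    s (s≤s z≤n) j = cong (λ z → digit z j) (*-identityʳ s)
  digit-high {a} (suc L) s a<b^[1+L] j =
    trans (cong (λ z → digit z (L + j)) ([m+place]/b a s L))
      (digit-high L s (/b-<-^ L a<b^[1+L]) j)

  digit-+-place : ∀ {n c} t → digit n t ≡ 0 → c < b →
    digit (n + place c t) t ≡ c × (∀ {j} → j ≢ t → digit (n + place c t) j ≡ digit n j)
  digit-+-place {n} {c} zero n%b≡0 c<b = at-0 , off-0
    where
    n+c≡c+[n/b]b : n + place c 0 ≡ c + n / b * b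
    n+c≡c+[n/b]b = begin
      n + c * 1               ≡⟨ cong₂ _+_ (m≡m%n+[m/n]*n n b) (*-identityʳ c) ⟩
      n % b + n / b * b + c   ≡⟨ cong (λ r → r + n / b * b + c) n%b≡0 ⟩
      n / b * b + c           ≡⟨ +-comm (n / b * b) c ⟩
      c + n / b * b           ∎
      where open ≡-Reasoning
    at-0 : (n + place c 0) % b ≡ c
    at-0 = trans (cong (_% b) n+c≡c+[n/b]b)
      (trans ([m+kn]%n≡m%n c (n / b) b) (m<n⇒m%n≡m c<b))
    off-0 : ∀ {j} → j ≢ 0 → digit (n + place c 0) j ≡ digit n j
    off-0 {zero}  j≢0 = ⊥-elim (j≢0 refl)
    off-0 {suc j} _   = cong (λ z → digit z j)
      (trans (cong (_/ b) n+c≡c+[n/b]b)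
        (trans ([m+kb]/b≡m/b+k c (n / b)) (cong (_+ n / b) (m<n⇒m/n≡0 c<b))))
  digit-+-place {n} {c} (suc t) n[1+t]≡0 c<b = at-t , off-t
    where
    shifted = digit-+-place {n / b} t n[1+t]≡0 c<b
    at-t : digit (n + place c (suc t)) (suc t) ≡ c
    at-t = trans (cong (λ z → digit z t) ([m+place]/b n c t)) (proj₁ shifted)
    off-t : ∀ {j} → j ≢ suc t → digit (n + place c (suc t)) j ≡ digit n j
    off-t {zero}  _      = [m+place]%b n c t
    off-t {suc j} j≢1+t  =
      trans (cong (λ z → digit z j) ([m+place]/b n c t))
        (proj₂ shifted (λ j≡t → j≢1+t (cong suc j≡t)))

  digit-+-Σplace : ∀ {c} → c < b → ∀ H n → Unique H → (∀ {t} → t ∈ H → digit n t ≡ 0) →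
    (∀ {j} → j ∈ H → digit (n + ΣH (place c) H) j ≡ c) ×
    (∀ {j} → j ∉ H → digit (n + ΣH (place c) H) j ≡ digit n j)
  digit-+-Σplace c<b []      n _ _ = (λ ()) , λ {j} _ → cong (λ z → digit z j) (+-identityʳ n)
  digit-+-Σplace {c} c<b (t ∷ H) n (t≢H ∷ unique) H-free = on , off
    where
    t∉H : t ∉ H
    t∉H = All¬⇒¬Any t≢H
    at-t = digit-+-place t (H-free (here refl)) c<b
    rest = digit-+-Σplace c<b H (n + place c t) unique λ {u} u∈H →
      trans (proj₂ at-t (λ u≡t → t∉H (subst (_∈ H) u≡t u∈H))) (H-free (there u∈H))
    digit-reassoc : ∀ j →
      digit (n + (place c t + ΣH (place c) H)) j ≡ digit (n + place c t + ΣH (place c) H) j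
    digit-reassoc j = cong (λ z → digit z j) (sym (+-assoc n (place c t) _))
    on : ∀ {j} → j ∈ t ∷ H → digit (n + ΣH (place c) (t ∷ H)) j ≡ c
    on {j} (here refl) = trans (digit-reassoc j) (trans (proj₂ rest t∉H) (proj₁ at-t))
    on {j} (there j∈H) = trans (digit-reassoc j) (proj₁ rest j∈H)
    off : ∀ {j} → j ∉ t ∷ H → digit (n + ΣH (place c) (t ∷ H)) j ≡ digit n j
    off {j} j∉t∷H = trans (digit-reassoc j)
      (trans (proj₂ rest (λ j∈H → j∉t∷H (there j∈H)))
             (proj₂ at-t (λ j≡t → j∉t∷H (here j≡t))))

∈⇒≤ΣH : ∀ x {H t} → t ∈ H → x t ≤ ΣH x H
∈⇒≤ΣH x (here refl) = m≤m+n _ _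
∈⇒≤ΣH x {u ∷ _} (there t∈H) = ≤-trans (∈⇒≤ΣH x t∈H) (m≤n+m _ (x u))

module Run {Q : Set} (δ : Q → ℕ → Q) where

  run : ℕ → (ℕ → ℕ) → Q → Q
  run zero    f q = q
  run (suc N) f q = δ (run N f q) (f N)

  run-+ : ∀ L K f q → run (L + K) f q ≡ run K (λ j → f (L + j)) (run L f q)
  run-+ L zero    f q = cong (λ N → run N f q) (+-identityʳ L)
  run-+ L (suc K) f q =
    trans (cong (λ N → run N f q) (+-suc L K)) (cong (λ r → δ r (f (L + K))) (run-+ L K f q))

  run-cong : ∀ N {f g} q → (∀ {j} → j < N → f j ≡ g j) → run N f q ≡ run N g q
  run-cong zero    q f≗g = refl
  run-cong (suc N) q f≗g = cong₂ δ (run-cong N q (restrict-< f≗g)) (f≗g ≤-refl)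

  module _ (δ-0 : ∀ q → δ q 0 ≡ q) where

    run-zeros : ∀ N {f} q → (∀ {j} → j < N → f j ≡ 0) → run N f q ≡ q
    run-zeros zero    q _   = refl
    run-zeros (suc N) {f} q f≡0 = begin
      δ (run N f q) (f N) ≡⟨ cong₂ δ (run-zeros N q (restrict-< f≡0)) (f≡0 ≤-refl) ⟩
      δ q 0               ≡⟨ δ-0 q ⟩
      q                   ∎
      where open ≡-Reasoning

    run-extend : ∀ {N M f} q → N ≤ M → (∀ {j} → N ≤ j → f j ≡ 0) → run M f q ≡ run N f q
    run-extend {N} {M} {f} q N≤M f≡0 = begin
      run M f q
        ≡⟨ cong (λ L → run L f q) (m+[n∸m]≡n N≤M) ⟨
      run (N + (M ∸ N)) f q
        ≡⟨ run-+ N (M ∸ N) f q ⟩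
      run (M ∸ N) (λ j → f (N + j)) (run N f q)
        ≡⟨ run-zeros (M ∸ N) _ (λ {j} _ → f≡0 (m≤m+n N j)) ⟩
      run N f q ∎
      where open ≡-Reasoning

data State : Set where
  start ones twos dead : State

δ : State → ℕ → State
δ start 0 = start
δ start 1 = ones
δ ones  0 = ones
δ ones  1 = ones
δ ones  2 = twos
δ twos  0 = twos
δ twos  2 = twos
δ _     _ = dead

δ-0 : ∀ q → δ q 0 ≡ q
δ-0 start = refl
δ-0 ones  = refl
δ-0 twos  = refl
δ-0 dead  = refl

open Run δ
open Digits 3

-- The set B; reading n digits of n reads all of them, since n < 3ⁿ.
OnesThenTwos : Subset
OnesThenTwos n = run n (digit n) start ≡ twos

isTwos? : ∀ q → Dec (q ≡ twos)
isTwos? start = no λ ()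
isTwos? ones  = no λ ()
isTwos? twos  = yes refl
isTwos? dead  = no λ ()

onesThenTwos? : Decidable OnesThenTwos
onesThenTwos? n = isTwos? (run n (digit n) start)

n<3^n : ∀ n → n < 3 ^ n
n<3^n = n<m^n 3 (s<s z<s)

run-digits-stable : ∀ {n} N q → n < 3 ^ N → run N (digit n) q ≡ run n (digit n) q
run-digits-stable {n} N q n<3^N with ≤-total n N
... | inj₁ n≤N = run-extend δ-0 q n≤N (digit-vanishes (n<3^n n))
... | inj₂ N≤n = sym (run-extend δ-0 q N≤n (digit-vanishes n<3^N))

run-digits-concat : ∀ {a} L K s q → a < 3 ^ L →
  run (L + K) (digit (a + place s L)) q ≡ run K (digit s) (run L (digit a) q)
run-digits-concat {a} L K s q a<3^L = begin
  run (L + K) (digit (a + place s L)) q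
    ≡⟨ run-+ L K _ q ⟩
  run K (λ j → digit (a + place s L) (L + j)) (run L (digit (a + place s L)) q)
    ≡⟨ run-cong K _ (λ {j} _ → digit-high L s a<3^L j) ⟩
  run K (digit s) (run L (digit (a + place s L)) q)
    ≡⟨ cong (run K (digit s)) (run-cong L q (digit-low L s a<3^L)) ⟩
  run K (digit s) (run L (digit a) q)
    ∎
  where open ≡-Reasoning

-- Runs from start and from twos on the same word: as long as start has not moved, twos has not
-- moved either, and the digit that moves start away (1, or anything above) kills twos.
data Shadowing : State → State → Set where
  waiting    : Shadowing start twos
  start-dead : ∀ {q} → Shadowing dead q
  twos-dead  : ∀ {p} → Shadowing p dead

δ-shadowing : ∀ {p q} → Shadowing p q → ∀ d → Shadowing (δ p d) (δ q d)
δ-shadowing waiting    0             = waiting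
δ-shadowing waiting    1             = twos-dead
δ-shadowing waiting    (suc (suc _)) = start-dead
δ-shadowing start-dead _             = start-dead
δ-shadowing twos-dead  _             = twos-dead

run-shadowing : ∀ K f → Shadowing (run K f start) (run K f twos)
run-shadowing zero    f = waiting
run-shadowing (suc K) f = δ-shadowing (run-shadowing K f) (f K)

accepted⇒kills-twos : ∀ K f → run K f start ≡ twos → run K f twos ≡ dead
accepted⇒kills-twos K f = shadowing⇒ (run-shadowing K f)
  where
  shadowing⇒ : ∀ {p q} → Shadowing p q → p ≡ twos → q ≡ dead
  shadowing⇒ waiting    ()
  shadowing⇒ start-dead ()
  shadowing⇒ twos-dead  _ = refl

onesThenTwos-concat : ∀ {a L s} → a < 3 ^ L → 3 ^ L ∣ s →
  OnesThenTwos a → OnesThenTwos s → ¬ OnesThenTwos (a + s)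
onesThenTwos-concat {a} {L} a<3^L (divides-refl s) a∈ s∈ a+s∈ =
  dead≢twos (trans (sym rejected) accepted)
  where
  dead≢twos : dead ≢ twos
  dead≢twos ()
  m = a + place s L
  short : ∀ {x} → x ≤ m → x < 3 ^ (L + m)
  short x≤m = <-≤-trans (≤-<-trans x≤m (n<3^n m)) (^-monoʳ-≤ 3 (m≤n+m m L))
  s-accepted : run m (digit s) start ≡ twos
  s-accepted = begin
    run m (digit s) start
      ≡⟨ cong (run m (digit s)) (run-digits-stable L start (m^n>0 3 L)) ⟨
    run m (digit s) (run L (digit 0) start)
      ≡⟨ run-digits-concat L m s start (m^n>0 3 L) ⟨
    run (L + m) (digit (place s L)) start
      ≡⟨ run-digits-stable (L + m) start (short (m≤n+m (place s L) a)) ⟩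
    run (place s L) (digit (place s L)) start
      ≡⟨ s∈ ⟩
    twos ∎
    where open ≡-Reasoning
  accepted : run (L + m) (digit m) start ≡ twos
  accepted = trans (run-digits-stable (L + m) start (short ≤-refl)) a+s∈
  rejected : run (L + m) (digit m) start ≡ dead
  rejected = begin
    run (L + m) (digit m) start
      ≡⟨ run-digits-concat L m s start a<3^L ⟩
    run m (digit s) (run L (digit a) start)
      ≡⟨ cong (run m (digit s)) (trans (run-digits-stable L start a<3^L) a∈) ⟩
    run m (digit s) twos
      ≡⟨ accepted⇒kills-twos m (digit s) s-accepted ⟩
    dead ∎
    where open ≡-Reasoning

data BeforeTwo : State → Set where
  at-start : BeforeTwo start
  at-ones  : BeforeTwo ones

δ-ones : ∀ {d} → d ≤ 1 → δ ones d ≡ ones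
δ-ones z≤n       = refl
δ-ones (s≤s z≤n) = refl

δ-1 : ∀ {q} → BeforeTwo q → δ q 1 ≡ ones
δ-1 at-start = refl
δ-1 at-ones  = refl

δ-twos : ∀ {d} → d ≡ 0 ⊎ d ≡ 2 → δ twos d ≡ twos
δ-twos (inj₁ refl) = refl
δ-twos (inj₂ refl) = refl

δ-binary : ∀ {q d} → BeforeTwo q → d ≤ 1 → BeforeTwo (δ q d)
δ-binary at-start z≤n       = at-start
δ-binary at-start (s≤s z≤n) = at-ones
δ-binary at-ones  d≤1       = subst BeforeTwo (sym (δ-ones d≤1)) at-ones

run-binary : ∀ {f} j → (∀ {i} → i < j → f i ≤ 1) → BeforeTwo (run j f start)
run-binary zero    _   = at-start
run-binary (suc j) f≤1 = δ-binary (run-binary j (restrict-< f≤1)) (f≤1 ≤-refl)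

run-after-1 : ∀ {f h} j → (∀ {i} → i < j → f i ≤ 1) → h < j → f h ≡ 1 → run j f start ≡ ones
run-after-1 {f} (suc j) f≤1 (s≤s h≤j) fh≡1 with m≤n⇒m<n∨m≡n h≤j
... | inj₁ h<j  =
  trans (cong (λ q → δ q (f j)) (run-after-1 j (restrict-< f≤1) h<j fh≡1)) (δ-ones (f≤1 ≤-refl))
... | inj₂ refl = trans (cong (δ (run j f start)) fh≡1) (δ-1 (run-binary j (restrict-< f≤1)))

run-after-2 : ∀ {f h p} j → (∀ {i} → i < p → f i ≤ 1) → (∀ {i} → p ≤ i → f i ≡ 0 ⊎ f i ≡ 2) →
  h < p → f h ≡ 1 → f p ≡ 2 → p < j → run j f start ≡ twos
run-after-2 {f} (suc j) f≤1 f∈02 h<p fh≡1 fp≡2 (s≤s p≤j) with m≤n⇒m<n∨m≡n p≤j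
... | inj₁ p<j  =
  trans (cong (λ q → δ q (f j)) (run-after-2 j f≤1 f∈02 h<p fh≡1 fp≡2 p<j)) (δ-twos (f∈02 p≤j))
... | inj₂ refl = cong₂ δ (run-after-1 j f≤1 h<p fh≡1) fp≡2

onesThenTwos-Σplace : ∀ {H₁ H₂} → IsFinSet H₁ → IsFinSet H₂ → H₁ ≺ H₂ →
  OnesThenTwos (ΣH (place 1) H₁ + ΣH (place 2) H₂)
onesThenTwos-Σplace {H₁@(h ∷ _)} {H₂@(y ∷ ys)} (_ , unique₁) (_ , unique₂) H₁≺H₂ =
  run-after-2 m below-p from-p (H₁<H₂ (here refl) p∈H₂) (digit-1 (here refl)) (digit-2 p∈H₂) p<m
  where
  E = ΣH (place 1) H₁
  F = ΣH (place 2) H₂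
  m = E + F
  H₁<H₂ : ∀ {i j} → i ∈ H₁ → j ∈ H₂ → i < j
  H₁<H₂ i∈H₁ j∈H₂ = lookup (lookup H₁≺H₂ i∈H₁) j∈H₂
  H₂∉H₁ : ∀ {j} → j ∈ H₂ → j ∉ H₁
  H₂∉H₁ j∈H₂ j∈H₁ = <-irrefl refl (H₁<H₂ j∈H₁ j∈H₂)
  digits-E = digit-+-Σplace (s<s z<s) H₁ 0 unique₁ (λ {t} _ → digit-zero t)
  digits-m = digit-+-Σplace (s<s (s<s z<s)) H₂ E unique₂ λ {t} t∈H₂ →
    trans (proj₂ digits-E (H₂∉H₁ t∈H₂)) (digit-zero t)
  digit-1 : ∀ {i} → i ∈ H₁ → digit m i ≡ 1
  digit-1 i∈H₁ = trans (proj₂ digits-m (λ i∈H₂ → H₂∉H₁ i∈H₂ i∈H₁)) (proj₁ digits-E i∈H₁)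
  digit-2 : ∀ {j} → j ∈ H₂ → digit m j ≡ 2
  digit-2 = proj₁ digits-m
  digit-0 : ∀ {i} → i ∉ H₁ → i ∉ H₂ → digit m i ≡ 0
  digit-0 {i} i∉H₁ i∉H₂ = trans (proj₂ digits-m i∉H₂) (trans (proj₂ digits-E i∉H₁) (digit-zero i))
  p = min y ys
  p∈H₂ : p ∈ H₂
  p∈H₂ = [ here , there ]′ (argmin-sel id y ys)
  p≤H₂ : ∀ {j} → j ∈ H₂ → p ≤ j
  p≤H₂ = lookup (min≤⊤ y ys ∷ min≤xs y ys)
  below-p : ∀ {i} → i < p → digit m i ≤ 1
  below-p {i} i<p with i ∈? H₁
  ... | yes i∈H₁ = ≤-reflexive (digit-1 i∈H₁)
  ... | no  i∉H₁ = ≤-trans (≤-reflexive (digit-0 i∉H₁ (λ i∈H₂ → <⇒≱ i<p (p≤H₂ i∈H₂)))) z≤n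
  from-p : ∀ {i} → p ≤ i → digit m i ≡ 0 ⊎ digit m i ≡ 2
  from-p {i} p≤i with i ∈? H₂
  ... | yes i∈H₂ = inj₂ (digit-2 i∈H₂)
  ... | no  i∉H₂ = inj₁ (digit-0 (λ i∈H₁ → <⇒≱ (H₁<H₂ i∈H₁ p∈H₂) p≤i) i∉H₂)
  p<m : p < m
  p<m = <-≤-trans (n<3^n p)
    (≤-trans (m≤n*m (3 ^ p) 2) (≤-trans (∈⇒≤ΣH (place 2) p∈H₂) (m≤n+m F E)))

onesThenTwos-IP² : IPnSet 2 OnesThenTwos
onesThenTwos-IP² = x , (λ i t → *-mono-≤ {1} {suc (toℕ i)} z<s (m^n>0 3 t)) , λ H finite H≺ →
  subst OnesThenTwos (cong (ΣH (x zero) (H zero) +_) (sym (+-identityʳ _)))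
    (onesThenTwos-Σplace (finite zero) (finite (suc zero)) (H≺ zero (suc zero) refl))
  where
  x : Fin 2 → ℕ → ℕ
  x i = place (suc (toℕ i))

iterate-suc-≥ : ∀ b n → All (b ≤_) (iterate suc b n)
iterate-suc-≥ b zero    = []
iterate-suc-≥ b (suc n) = ≤-refl ∷ All.map <⇒≤ (iterate-suc-≥ (suc b) n)

iterate-suc-unique : ∀ b n → Unique (iterate suc b n)
iterate-suc-unique b zero    = []
iterate-suc-unique b (suc n) = All.map <⇒≢ (iterate-suc-≥ (suc b) n) ∷ iterate-suc-unique (suc b) n

ΣH-iterate-suc-+ : ∀ x b m n →
  ΣH x (iterate suc b (m + n)) ≡ ΣH x (iterate suc b m) + ΣH x (iterate suc (b + m) n)
ΣH-iterate-suc-+ x b zero    n = cong (λ c → ΣH x (iterate suc c n)) (sym (+-identityʳ b))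
ΣH-iterate-suc-+ x b (suc m) n = begin
  x b + ΣH x (iterate suc (suc b) (m + n))
    ≡⟨ cong (x b +_) (ΣH-iterate-suc-+ x (suc b) m n) ⟩
  x b + (ΣH x (iterate suc (suc b) m) + ΣH x (iterate suc (suc b + m) n))
    ≡⟨ +-assoc (x b) _ _ ⟨
  x b + ΣH x (iterate suc (suc b) m) + ΣH x (iterate suc (suc b + m) n)
    ≡⟨ cong (λ c → x b + ΣH x (iterate suc (suc b) m) + ΣH x (iterate suc c n)) (+-suc b m) ⟨
  x b + ΣH x (iterate suc (suc b) m) + ΣH x (iterate suc (b + suc m) n)
    ∎
  where open ≡-Reasoning

%-≡⇒∣ : ∀ m k M .{{_ : NonZero M}} → m % M ≡ (m + k) % M → M ∣ k
%-≡⇒∣ m k M m%M≡[m+k]%M = ∣m+n∣m⇒∣n (divides ((m + k) / M) q+k≡q′) (n∣m*n (m / M))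
  where
  q+k≡q′ : m / M * M + k ≡ (m + k) / M * M
  q+k≡q′ = +-cancelˡ-≡ (m % M) _ _ (begin
    m % M + (m / M * M + k)      ≡⟨ +-assoc (m % M) _ k ⟨
    m % M + m / M * M + k        ≡⟨ cong (_+ k) (m≡m%n+[m/n]*n m M) ⟨
    m + k                        ≡⟨ m≡m%n+[m/n]*n (m + k) M ⟩
    (m + k) % M + (m + k) / M * M ≡⟨ cong (_+ (m + k) / M * M) m%M≡[m+k]%M ⟨
    m % M + (m + k) / M * M      ∎)
    where open ≡-Reasoning

block-sum-divisible : ∀ M .{{_ : NonZero M}} x → ∃₂ λ i d → M ∣ ΣH x (iterate suc (suc i) (suc d))
block-sum-divisible M x with pigeonhole (n<1+n M) (λ k → ΣH x (iterate suc 1 (toℕ k)) mod M)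
... | i , j , i<j , ≡-mod with m≤n⇒∃[o]m+o≡n i<j
... | d , 1+i+d≡j = toℕ i , d , %-≡⇒∣ (prefix (toℕ i)) _ M (begin
  prefix (toℕ i) % M
    ≡⟨ fromℕ<-injective _ _ (m%n<n _ M) (m%n<n _ M) ≡-mod ⟩
  prefix (toℕ j) % M
    ≡⟨ cong (λ k → prefix k % M) (trans (+-suc (toℕ i) d) 1+i+d≡j) ⟨
  prefix (toℕ i + suc d) % M
    ≡⟨ cong (_% M) (ΣH-iterate-suc-+ x 1 (toℕ i) (suc d)) ⟩
  (prefix (toℕ i) + ΣH x (iterate suc (suc (toℕ i)) (suc d))) % M ∎)
  where
  prefix : ℕ → ℕ
  prefix k = ΣH x (iterate suc 1 k)
  open ≡-Reasoning

IPSet⇒divisible-triple : ∀ {B} b .{{_ : NonZero b}} → IPSet B →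
  ∃₂ λ a s → b ^ a ∣ s × B a × B s × B (a + s)
IPSet⇒divisible-triple {B} b (x , _ , FS⊆B) with block-sum-divisible (b ^ x 0) {{m^n≢0 b (x 0)}} x
... | i , d , b^a∣s =
  x 0 , ΣH x block , b^a∣s , a∈B ,
  FS⊆B block (tt , block-unique) , FS⊆B (0 ∷ block) (tt , 0∉block ∷ block-unique)
  where
  block = iterate suc (suc i) (suc d)
  block-unique : Unique block
  block-unique = iterate-suc-unique (suc i) (suc d)
  0∉block : All (0 ≢_) block
  0∉block = All.map (λ 1+i≤t → <⇒≢ (<-≤-trans z<s 1+i≤t)) (iterate-suc-≥ (suc i) (suc d))
  a∈B : B (x 0)
  a∈B = subst B (+-identityʳ (x 0)) (FS⊆B (0 ∷ []) (tt , [] ∷ []))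

∁onesThenTwos-IP⋆ : IPStar (∁ OnesThenTwos)
∁onesThenTwos-IP⋆ B ipB with IPSet⇒divisible-triple 3 ipB
... | a , s , 3^a∣s , a∈B , s∈B , a+s∈B with onesThenTwos? a | onesThenTwos? s | onesThenTwos? (a + s)
... | no a∉   | _      | _        = a , a∉ , a∈B
... | yes _   | no s∉  | _        = s , s∉ , s∈B
... | yes _   | yes _  | no a+s∉  = a + s , a+s∉ , a+s∈B
... | yes a∈  | yes s∈ | yes a+s∈ = ⊥-elim (onesThenTwos-concat {L = a} (n<3^n a) 3^a∣s a∈ s∈ a+s∈)

mainTheorem3 : Σ Subset λ A → IPStar A × ¬ IPnStar 2 A
mainTheorem3 = ∁ OnesThenTwos , ∁onesThenTwos-IP⋆ , λ ∁B-IP²⋆ →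
  let (m , m∉B , m∈B) = ∁B-IP²⋆ OnesThenTwos onesThenTwos-IP² in m∉B m∈B
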